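{- Let $w=a_1^k v a_1^m\in M_2$, where $v$ is a word with first letter $v_1=a_2$ and last letter $v_{fin}=a_2$, and $k,m>0$. Then, up to equivalence (i.e. modulo bounded functions), \[\rho_w=\rho_v-\sum_{i=0}^{k-1}\rho_{a_2a_1^iv}-\sum_{j=0}^{m-1}\rho_{va_1^ja_2}+\sum_{i=0}^{k-1}\sum_{j=0}^{m-1}\rho_{a_2a_1^iva_1^ja_2}.\]
   Context: $M_2$ is the free monoid over $\{a_1,a_2\}$. For a word $u$, $\rho_u(w)$ is the number of (possibly overlapping) occurrences of $u$ as a contiguous subword of $w$, and $\rho_\epsilon(w)=|w|$. Counting functions are finite linear combinations of such $\rho_u$; two counting functions are equivalent (written $=$) if their difference is a bounded function on $M_2$. -}

module Defs where

open import Data.Nat using (ℕ; zero; suc)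
open import Data.Bool using (Bool; true; false; _∧_)
open import Data.Integer using (ℤ; +_; _-_; ∣_∣)
open import Data.List using (List; []; _∷_; length)
open import Data.Product using (∃)
import Data.Nat as ℕ

data Letter : Set where
  a₁ a₂ : Letter

Word : Set
Word = List Letter

_==_ : Letter → Letter → Bool
a₁ == a₁ = true
a₂ == a₂ = true
_  == _  = false

isPrefix : Word → Word → Bool
isPrefix []      _        = true
isPrefix (_ ∷ _) []       = false
isPrefix (x ∷ u) (y ∷ w)  = (x == y) ∧ isPrefix u w

bit : Bool → ℕ
bit true  = 1
bit false = 0

-- number of (possibly overlapping) occurrences of a NONEMPTY word u as a
-- contiguous subword of w: number of suffixes of w having u as a prefix
occ : Word → Word → ℕ
occ u []      = 0
occ u (x ∷ w) = bit (isPrefix u (x ∷ w)) ℕ.+ occ u w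

ρ : Word → Word → ℕ
ρ []      w = length w
ρ (x ∷ u) w = occ (x ∷ u) w

CountingFunction : Set
CountingFunction = Word → ℤ

ρℤ : Word → CountingFunction
ρℤ u w = + ρ u w

_⊕_ : CountingFunction → CountingFunction → CountingFunction
(f ⊕ g) w = f w Data.Integer.+ g w

_⊖_ : CountingFunction → CountingFunction → CountingFunction
(f ⊖ g) w = f w - g w

𝟎 : CountingFunction
𝟎 _ = + 0

Σ< : ℕ → (ℕ → CountingFunction) → CountingFunction
Σ< zero    f = 𝟎
Σ< (suc n) f = Σ< n f ⊕ f n

_≈_ : CountingFunction → CountingFunction → Set
f ≈ g = ∃ λ (C : ℕ) → ∀ (w : Word) → ∣ f w - g w ∣ ℕ.≤ C

infixl 6 _⊕_ _⊖_
infix 4 _≈_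

-- Every occurrence of u in w is either a prefix of w or is preceded by a letter, so
-- ρ_u = ρ_{a₂u} + ρ_{a₁u} up to the bounded term [u is a prefix of w]; symmetrically
-- ρ_u = ρ_{ua₂} + ρ_{ua₁} up to [u is a suffix of w].  Iterating the first identity k
-- times telescopes to ρ_{a₁ᵏu} = ρ_u − Σ_{i<k} ρ_{a₂a₁ⁱu}, and likewise on the right.
-- Peeling a₁ᵏ off w = a₁ᵏva₁ᵐ on the left, then a₁ᵐ off every resulting word on the
-- right, gives the formula.
module Submission where

open import Defs
open import Data.Nat using (ℕ; suc; _<_)
open import Data.List using (_∷_; []; _++_; replicate; head; last; length)
open import Data.Maybe using (just)
open import Relation.Binary.PropositionalEquality using (_≡_)

open import Data.Bool using (Bool; true; false; _∧_)
open import Data.Empty using (⊥-elim)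
open import Data.Integer as ℤ using (+_; _-_; ∣_∣)
open import Data.Integer.Properties using (∣i+j∣≤∣i∣+∣j∣; ∣i-j∣≤∣i∣+∣j∣; i≡j⇒i-j≡0)
open import Data.Integer.Tactic.RingSolver using (solve-∀)
open import Data.List.Properties using (++-assoc; ++-identityʳ)
import Data.Nat as ℕ
open import Data.Nat using (_≤_; z≤n; s≤s)
open import Data.Nat.Properties
  using (≤-refl; ≤-reflexive; ≤-trans; +-mono-≤; +-identityʳ; +-assoc; <-irrefl; <-trans; n<1+n)
import Data.Nat.Tactic.RingSolver as ℕ-Solver
open import Data.Product using (_,_)
open import Relation.Binary.Bundles using (Setoid)
import Relation.Binary.Reasoning.Setoid as SetoidReasoning
open import Relation.Binary.PropositionalEquality
  using (refl; sym; trans; cong; cong₂; subst; _≗_; module ≡-Reasoning)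

record Bounded (f : CountingFunction) : Set where
  constructor bounded
  field
    bound    : ℕ
    ∣∣≤bound : ∀ w → ∣ f w ∣ ≤ bound

-- Defs._≈_ unfolds to an ∃-type from which Agda cannot infer its two arguments;
-- _∼_ is the same relation as a record, whose indices are inferable.
record _∼_ (f g : CountingFunction) : Set where
  constructor ⟨_⟩
  field
    bounded-difference : Bounded (f ⊖ g)

infix 4 _∼_

∼⇒≈ : {f g : CountingFunction} → f ∼ g → f ≈ g
∼⇒≈ ⟨ bounded C ∣f-g∣≤C ⟩ = C , ∣f-g∣≤C

bounded-resp : {f g : CountingFunction} → f ≗ g → Bounded f → Bounded g
bounded-resp f≗g (bounded C ∣f∣≤C) = bounded C λ w → subst (λ z → ∣ z ∣ ≤ C) (f≗g w) (∣f∣≤C w)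

bounded-𝟎 : Bounded 𝟎
bounded-𝟎 = bounded 0 λ _ → z≤n

bounded-⊕ : {f g : CountingFunction} → Bounded f → Bounded g → Bounded (f ⊕ g)
bounded-⊕ {f} {g} (bounded C ∣f∣≤C) (bounded D ∣g∣≤D) =
  bounded (C ℕ.+ D) λ w → ≤-trans (∣i+j∣≤∣i∣+∣j∣ (f w) (g w)) (+-mono-≤ (∣f∣≤C w) (∣g∣≤D w))

bounded-⊖ : {f g : CountingFunction} → Bounded f → Bounded g → Bounded (f ⊖ g)
bounded-⊖ {f} {g} (bounded C ∣f∣≤C) (bounded D ∣g∣≤D) =
  bounded (C ℕ.+ D) λ w → ≤-trans (∣i-j∣≤∣i∣+∣j∣ (f w) (g w)) (+-mono-≤ (∣f∣≤C w) (∣g∣≤D w))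

≗⇒∼ : {f g : CountingFunction} → f ≗ g → f ∼ g
≗⇒∼ f≗g = ⟨ bounded-resp (λ w → sym (i≡j⇒i-j≡0 (f≗g w))) bounded-𝟎 ⟩

∼-refl : {f : CountingFunction} → f ∼ f
∼-refl = ≗⇒∼ (λ _ → refl)

∼-sym : {f g : CountingFunction} → f ∼ g → g ∼ f
∼-sym {f} {g} ⟨ f-g ⟩ = ⟨ bounded-resp (λ w → lemma (f w) (g w)) (bounded-⊖ bounded-𝟎 f-g) ⟩
  where
  lemma : ∀ x y → + 0 - (x - y) ≡ y - x
  lemma = solve-∀

∼-trans : {f g h : CountingFunction} → f ∼ g → g ∼ h → f ∼ h
∼-trans {f} {g} {h} ⟨ f-g ⟩ ⟨ g-h ⟩ =
  ⟨ bounded-resp (λ w → lemma (f w) (g w) (h w)) (bounded-⊕ f-g g-h) ⟩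
  where
  lemma : ∀ x y z → (x - y) ℤ.+ (y - z) ≡ x - z
  lemma = solve-∀

∼-setoid : Setoid _ _
∼-setoid = record
  { Carrier       = CountingFunction
  ; _≈_           = _∼_
  ; isEquivalence = record { refl = ∼-refl ; sym = ∼-sym ; trans = ∼-trans }
  }

⊕-cong : {f g f′ g′ : CountingFunction} → f ∼ f′ → g ∼ g′ → f ⊕ g ∼ f′ ⊕ g′
⊕-cong {f} {g} {f′} {g′} ⟨ f-f′ ⟩ ⟨ g-g′ ⟩ =
  ⟨ bounded-resp (λ w → lemma (f w) (g w) (f′ w) (g′ w)) (bounded-⊕ f-f′ g-g′) ⟩
  where
  lemma : ∀ x y x′ y′ → (x - x′) ℤ.+ (y - y′) ≡ (x ℤ.+ y) - (x′ ℤ.+ y′)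
  lemma = solve-∀

⊖-cong : {f g f′ g′ : CountingFunction} → f ∼ f′ → g ∼ g′ → f ⊖ g ∼ f′ ⊖ g′
⊖-cong {f} {g} {f′} {g′} ⟨ f-f′ ⟩ ⟨ g-g′ ⟩ =
  ⟨ bounded-resp (λ w → lemma (f w) (g w) (f′ w) (g′ w)) (bounded-⊖ f-f′ g-g′) ⟩
  where
  lemma : ∀ x y x′ y′ → (x - x′) - (y - y′) ≡ (x - y) - (x′ - y′)
  lemma = solve-∀

Σ<-cong : ∀ n {f g : ℕ → CountingFunction} → (∀ i → f i ∼ g i) → Σ< n f ∼ Σ< n g
Σ<-cong ℕ.zero  f∼g = ∼-refl
Σ<-cong (suc n) f∼g = ⊕-cong (Σ<-cong n f∼g) (f∼g n)

Σ<-⊖ : ∀ n (f g : ℕ → CountingFunction) → Σ< n (λ i → f i ⊖ g i) ≗ Σ< n f ⊖ Σ< n g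
Σ<-⊖ ℕ.zero  f g w = refl
Σ<-⊖ (suc n) f g w = trans (cong (ℤ._+ (f n w - g n w)) (Σ<-⊖ n f g w))
                           (lemma (Σ< n f w) (Σ< n g w) (f n w) (g n w))
  where
  lemma : ∀ a b c d → (a - b) ℤ.+ (c - d) ≡ (a ℤ.+ c) - (b ℤ.+ d)
  lemma = solve-∀

∼-isolateʳ : {f g h : CountingFunction} → f ∼ g ⊕ h → h ∼ f ⊖ g
∼-isolateʳ {f} {g} {h} f∼g⊕h = begin
  h             ≈⟨ ≗⇒∼ (λ w → lemma (g w) (h w)) ⟩
  (g ⊕ h) ⊖ g   ≈⟨ ⊖-cong (∼-sym f∼g⊕h) ∼-refl ⟩
  f ⊖ g         ∎
  where
  open SetoidReasoning ∼-setoid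
  lemma : ∀ x y → y ≡ (x ℤ.+ y) - x
  lemma = solve-∀

telescope : (F G : ℕ → CountingFunction) → (∀ n → F n ∼ G n ⊕ F (suc n)) →
            ∀ k → F k ∼ F 0 ⊖ Σ< k G
telescope F G step ℕ.zero  = ≗⇒∼ (λ w → lemma (F 0 w))
  where
  lemma : ∀ x → x ≡ x - + 0
  lemma = solve-∀
telescope F G step (suc k) = begin
  F (suc k)              ≈⟨ ∼-isolateʳ (step k) ⟩
  F k ⊖ G k              ≈⟨ ⊖-cong (telescope F G step k) ∼-refl ⟩
  (F 0 ⊖ Σ< k G) ⊖ G k   ≈⟨ ≗⇒∼ (λ w → lemma (F 0 w) (Σ< k G w) (G k w)) ⟩
  F 0 ⊖ (Σ< k G ⊕ G k)   ∎
  where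
  open SetoidReasoning ∼-setoid
  lemma : ∀ x y z → (x - y) - z ≡ x - (y ℤ.+ z)
  lemma = solve-∀

∼-from-bounded-defects : (f g b c : Word → ℕ) {B C : ℕ} →
  (∀ w → f w ℕ.+ c w ≡ g w ℕ.+ b w) → (∀ w → b w ≤ B) → (∀ w → c w ≤ C) →
  (λ w → + f w) ∼ (λ w → + g w)
∼-from-bounded-defects f g b c {B} {C} f+c≡g+b b≤B c≤C =
  ⟨ bounded-resp b-c≡f-g (bounded-⊖ +b-bounded +c-bounded) ⟩
  where
  +b-bounded : Bounded (λ w → + b w)
  +b-bounded = bounded B b≤B
  +c-bounded : Bounded (λ w → + c w)
  +c-bounded = bounded C c≤C
  b-c≡f-g : ∀ w → + b w - + c w ≡ + f w - + g w
  b-c≡f-g w = begin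
    + b w - + c w                       ≡⟨ lemma₁ (+ b w) (+ c w) (+ g w) ⟩
    (+ g w ℤ.+ + b w) - + c w - + g w   ≡⟨ cong (λ x → + x - + c w - + g w) (f+c≡g+b w) ⟨
    (+ f w ℤ.+ + c w) - + c w - + g w   ≡⟨ lemma₂ (+ f w) (+ c w) (+ g w) ⟩
    + f w - + g w                       ∎
    where
    open ≡-Reasoning
    lemma₁ : ∀ x y z → x - y ≡ (z ℤ.+ x) - y - z
    lemma₁ = solve-∀
    lemma₂ : ∀ x y z → (x ℤ.+ y) - y - z ≡ x - z
    lemma₂ = solve-∀

bit≤1 : ∀ b → bit b ≤ 1
bit≤1 true  = s≤s z≤n
bit≤1 false = z≤n

ρ≗occ : ∀ u → ρ u ≗ occ u
ρ≗occ []      []      = refl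
ρ≗occ []      (_ ∷ w) = cong suc (ρ≗occ [] w)
ρ≗occ (_ ∷ _) _       = refl

bit-isPrefix-∷ : ∀ u y x →
  bit (isPrefix (a₂ ∷ u) (y ∷ x)) ℕ.+ bit (isPrefix (a₁ ∷ u) (y ∷ x)) ≡ bit (isPrefix u x)
bit-isPrefix-∷ u a₁ x = refl
bit-isPrefix-∷ u a₂ x = +-identityʳ _

-- bit (isPrefix u []) is 1 only for u = [], whose occurrence at position |w| occ does not count.
occ-∷ : ∀ u w → occ u w ℕ.+ bit (isPrefix u [])
              ≡ (occ (a₂ ∷ u) w ℕ.+ occ (a₁ ∷ u) w) ℕ.+ bit (isPrefix u w)
occ-∷ u []      = refl
occ-∷ u (y ∷ x) = begin
  (p ℕ.+ occ u x) ℕ.+ e                        ≡⟨ +-assoc p (occ u x) e ⟩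
  p ℕ.+ (occ u x ℕ.+ e)                        ≡⟨ cong (p ℕ.+_) (occ-∷ u x) ⟩
  p ℕ.+ ((o₂ ℕ.+ o₁) ℕ.+ bit (isPrefix u x))
    ≡⟨ cong (λ z → p ℕ.+ ((o₂ ℕ.+ o₁) ℕ.+ z)) (bit-isPrefix-∷ u y x) ⟨
  p ℕ.+ ((o₂ ℕ.+ o₁) ℕ.+ (b₂ ℕ.+ b₁))           ≡⟨ lemma p o₂ o₁ b₂ b₁ ⟩
  ((b₂ ℕ.+ o₂) ℕ.+ (b₁ ℕ.+ o₁)) ℕ.+ p           ∎
  where
  open ≡-Reasoning
  p  = bit (isPrefix u (y ∷ x))
  e  = bit (isPrefix u [])
  o₁ = occ (a₁ ∷ u) x
  o₂ = occ (a₂ ∷ u) x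
  b₁ = bit (isPrefix (a₁ ∷ u) (y ∷ x))
  b₂ = bit (isPrefix (a₂ ∷ u) (y ∷ x))
  lemma : ∀ a b c d e → a ℕ.+ ((b ℕ.+ c) ℕ.+ (d ℕ.+ e)) ≡ ((d ℕ.+ b) ℕ.+ (e ℕ.+ c)) ℕ.+ a
  lemma = ℕ-Solver.solve-∀

ρ-extendˡ : ∀ u → ρℤ u ∼ ρℤ (a₂ ∷ u) ⊕ ρℤ (a₁ ∷ u)
ρ-extendˡ u = ∼-from-bounded-defects (ρ u) (λ w → ρ (a₂ ∷ u) w ℕ.+ ρ (a₁ ∷ u) w)
  (λ w → bit (isPrefix u w)) (λ _ → bit (isPrefix u [])) defect (λ _ → bit≤1 _) (λ _ → bit≤1 _)
  where
  defect : ∀ w → ρ u w ℕ.+ bit (isPrefix u [])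
               ≡ (ρ (a₂ ∷ u) w ℕ.+ ρ (a₁ ∷ u) w) ℕ.+ bit (isPrefix u w)
  defect w = trans (cong (ℕ._+ _) (ρ≗occ u w)) (occ-∷ u w)

ρ-prefix-a₁ : ∀ u k →
  ρℤ (replicate k a₁ ++ u) ∼ ρℤ u ⊖ Σ< k (λ i → ρℤ (a₂ ∷ replicate i a₁ ++ u))
ρ-prefix-a₁ u = telescope (λ n → ρℤ (replicate n a₁ ++ u)) (λ n → ρℤ (a₂ ∷ replicate n a₁ ++ u))
  (λ n → ρ-extendˡ (replicate n a₁ ++ u))

_==ʷ_ : Word → Word → Bool
[]      ==ʷ []      = true
(x ∷ u) ==ʷ (y ∷ s) = (x == y) ∧ (u ==ʷ s)
_       ==ʷ _       = false

endOcc : Word → Word → ℕ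
endOcc u []      = 0
endOcc u (y ∷ x) = bit (u ==ʷ (y ∷ x)) ℕ.+ endOcc u x

==ʷ⇒length≡ : ∀ u s → u ==ʷ s ≡ true → length u ≡ length s
==ʷ⇒length≡ []      []      _ = refl
==ʷ⇒length≡ (x ∷ u) (y ∷ s) eq with x == y
... | true = cong suc (==ʷ⇒length≡ u s eq)
==ʷ⇒length≡ []      (_ ∷ _) ()
==ʷ⇒length≡ (_ ∷ _) []      ()

endOcc-short : ∀ u x → length x < length u → endOcc u x ≡ 0
endOcc-short u []      _  = refl
endOcc-short u (y ∷ x) lt with u ==ʷ (y ∷ x) in eq
... | true  = ⊥-elim (<-irrefl (sym (==ʷ⇒length≡ u (y ∷ x) eq)) lt)
... | false = endOcc-short u x (<-trans (n<1+n _) lt)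

endOcc≤1 : ∀ u w → endOcc u w ≤ 1
endOcc≤1 u []      = z≤n
endOcc≤1 u (y ∷ x) with u ==ʷ (y ∷ x) in eq
... | true  = s≤s (≤-reflexive (endOcc-short u x x<u))
  where
  x<u : length x < length u
  x<u = subst (length x <_) (sym (==ʷ⇒length≡ u (y ∷ x) eq)) (n<1+n _)
... | false = endOcc≤1 u x

bit-isPrefix-∷ʳ : ∀ u s →
  bit (isPrefix u s)
    ≡ (bit (isPrefix (u ++ a₂ ∷ []) s) ℕ.+ bit (isPrefix (u ++ a₁ ∷ []) s)) ℕ.+ bit (u ==ʷ s)
bit-isPrefix-∷ʳ []      []       = refl
bit-isPrefix-∷ʳ []      (a₁ ∷ _) = refl
bit-isPrefix-∷ʳ []      (a₂ ∷ _) = refl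
bit-isPrefix-∷ʳ (_ ∷ _) []       = refl
bit-isPrefix-∷ʳ (x ∷ u) (y ∷ s) with x == y
... | true  = bit-isPrefix-∷ʳ u s
... | false = refl

occ-∷ʳ : ∀ u w → occ u w ≡ (occ (u ++ a₂ ∷ []) w ℕ.+ occ (u ++ a₁ ∷ []) w) ℕ.+ endOcc u w
occ-∷ʳ u []      = refl
occ-∷ʳ u (y ∷ x) = begin
  bit (isPrefix u (y ∷ x)) ℕ.+ occ u x
    ≡⟨ cong₂ ℕ._+_ (bit-isPrefix-∷ʳ u (y ∷ x)) (occ-∷ʳ u x) ⟩
  ((b₂ ℕ.+ b₁) ℕ.+ e) ℕ.+ ((o₂ ℕ.+ o₁) ℕ.+ endOcc u x)
    ≡⟨ lemma b₂ b₁ e o₂ o₁ (endOcc u x) ⟩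
  ((b₂ ℕ.+ o₂) ℕ.+ (b₁ ℕ.+ o₁)) ℕ.+ (e ℕ.+ endOcc u x)
    ∎
  where
  open ≡-Reasoning
  e  = bit (u ==ʷ (y ∷ x))
  o₁ = occ (u ++ a₁ ∷ []) x
  o₂ = occ (u ++ a₂ ∷ []) x
  b₁ = bit (isPrefix (u ++ a₁ ∷ []) (y ∷ x))
  b₂ = bit (isPrefix (u ++ a₂ ∷ []) (y ∷ x))
  lemma : ∀ a b c d e f →
    ((a ℕ.+ b) ℕ.+ c) ℕ.+ ((d ℕ.+ e) ℕ.+ f) ≡ ((a ℕ.+ d) ℕ.+ (b ℕ.+ e)) ℕ.+ (c ℕ.+ f)
  lemma = ℕ-Solver.solve-∀

ρ-extendʳ : ∀ u → ρℤ u ∼ ρℤ (u ++ a₂ ∷ []) ⊕ ρℤ (u ++ a₁ ∷ [])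
ρ-extendʳ u = ∼-from-bounded-defects (ρ u) (λ w → ρ (u ++ a₂ ∷ []) w ℕ.+ ρ (u ++ a₁ ∷ []) w)
  (endOcc u) (λ _ → 0) defect (endOcc≤1 u) (λ _ → ≤-refl)
  where
  defect : ∀ w → ρ u w ℕ.+ 0 ≡ (ρ (u ++ a₂ ∷ []) w ℕ.+ ρ (u ++ a₁ ∷ []) w) ℕ.+ endOcc u w
  defect w rewrite +-identityʳ (ρ u w) | ρ≗occ u w
                 | ρ≗occ (u ++ a₂ ∷ []) w | ρ≗occ (u ++ a₁ ∷ []) w = occ-∷ʳ u w

replicate-∷ʳ : ∀ n (x : Letter) → replicate n x ++ x ∷ [] ≡ x ∷ replicate n x
replicate-∷ʳ ℕ.zero  x = refl
replicate-∷ʳ (suc n) x = cong (x ∷_) (replicate-∷ʳ n x)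

ρ-suffix-a₁ : ∀ u m →
  ρℤ (u ++ replicate m a₁) ∼ ρℤ u ⊖ Σ< m (λ j → ρℤ (u ++ replicate j a₁ ++ a₂ ∷ []))
ρ-suffix-a₁ u m = begin
  ρℤ (u ++ replicate m a₁)   ≈⟨ telescope F G step m ⟩
  F 0 ⊖ Σ< m G               ≡⟨ cong (λ x → ρℤ x ⊖ Σ< m G) (++-identityʳ u) ⟩
  ρℤ u ⊖ Σ< m G              ∎
  where
  open SetoidReasoning ∼-setoid
  F G : ℕ → CountingFunction
  F n = ρℤ (u ++ replicate n a₁)
  G n = ρℤ (u ++ replicate n a₁ ++ a₂ ∷ [])
  step : ∀ n → F n ∼ G n ⊕ F (suc n)
  step n = begin
    F n
      ≈⟨ ρ-extendʳ (u ++ replicate n a₁) ⟩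
    ρℤ ((u ++ replicate n a₁) ++ a₂ ∷ []) ⊕ ρℤ ((u ++ replicate n a₁) ++ a₁ ∷ [])
      ≡⟨ cong₂ (λ x y → ρℤ x ⊕ ρℤ y) (++-assoc u _ _)
               (trans (++-assoc u _ _) (cong (u ++_) (replicate-∷ʳ n a₁))) ⟩
    G n ⊕ F (suc n)
      ∎

lemma2p1 : (v : Word) → head v ≡ just a₂ → last v ≡ just a₂ → (k m : ℕ) → 0 < k → 0 < m →
  ρℤ (replicate k a₁ ++ v ++ replicate m a₁)
    ≈ ρℤ v
      ⊖ Σ< k (λ i → ρℤ (a₂ ∷ replicate i a₁ ++ v))
      ⊖ Σ< m (λ j → ρℤ (v ++ replicate j a₁ ++ a₂ ∷ []))
      ⊕ Σ< k (λ i → Σ< m (λ j → ρℤ (a₂ ∷ replicate i a₁ ++ v ++ replicate j a₁ ++ a₂ ∷ [])))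
lemma2p1 v _ _ k m _ _ = ∼⇒≈ (begin
  ρℤ (replicate k a₁ ++ v ++ replicate m a₁)
    ≈⟨ ρ-prefix-a₁ (v ++ replicate m a₁) k ⟩
  ρℤ (v ++ replicate m a₁) ⊖ Σ< k (λ i → ρℤ (a₂ ∷ replicate i a₁ ++ v ++ replicate m a₁))
    ≈⟨ ⊖-cong (ρ-suffix-a₁ v m) (Σ<-cong k peel-a₁ᵐ) ⟩
  (ρℤ v ⊖ Σ< m R) ⊖ Σ< k (λ i → L i ⊖ Σ< m (D i))
    ≈⟨ ≗⇒∼ rearrange ⟩
  ρℤ v ⊖ Σ< k L ⊖ Σ< m R ⊕ Σ< k (λ i → Σ< m (D i))
    ∎)
  where
  open SetoidReasoning ∼-setoid
  L R : ℕ → CountingFunction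
  L i = ρℤ (a₂ ∷ replicate i a₁ ++ v)
  R j = ρℤ (v ++ replicate j a₁ ++ a₂ ∷ [])
  D : ℕ → ℕ → CountingFunction
  D i j = ρℤ (a₂ ∷ replicate i a₁ ++ v ++ replicate j a₁ ++ a₂ ∷ [])

  peel-a₁ᵐ : ∀ i → ρℤ (a₂ ∷ replicate i a₁ ++ v ++ replicate m a₁) ∼ L i ⊖ Σ< m (D i)
  peel-a₁ᵐ i = begin
    ρℤ (a₂ ∷ replicate i a₁ ++ v ++ replicate m a₁)  ≡⟨ cong ρℤ (assoc (replicate m a₁)) ⟨
    ρℤ (u ++ replicate m a₁)                         ≈⟨ ρ-suffix-a₁ u m ⟩
    L i ⊖ Σ< m (λ j → ρℤ (u ++ replicate j a₁ ++ a₂ ∷ []))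
      ≈⟨ ⊖-cong (∼-refl {L i}) (Σ<-cong m λ j → ≗⇒∼ λ w → cong (λ x → ρℤ x w) (assoc _)) ⟩
    L i ⊖ Σ< m (D i)                                  ∎
    where
    u = a₂ ∷ replicate i a₁ ++ v
    assoc : ∀ x → u ++ x ≡ a₂ ∷ replicate i a₁ ++ v ++ x
    assoc x = cong (a₂ ∷_) (++-assoc (replicate i a₁) v x)

  rearrange : (ρℤ v ⊖ Σ< m R) ⊖ Σ< k (λ i → L i ⊖ Σ< m (D i))
            ≗ ρℤ v ⊖ Σ< k L ⊖ Σ< m R ⊕ Σ< k (λ i → Σ< m (D i))
  rearrange w = trans (cong ((ρℤ v ⊖ Σ< m R) w -_) (Σ<-⊖ k L (λ i → Σ< m (D i)) w))
                      (lemma (ρℤ v w) (Σ< m R w) (Σ< k L w) (Σ< k (λ i → Σ< m (D i)) w))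
    where
    lemma : ∀ a b c d → (a - b) - (c - d) ≡ ((a - c) - b) ℤ.+ d
    lemma = solve-∀
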